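{- Let $n,k$ be positive integers and $D$ a target distribution on $P_n^{(k)}$ with $|D|\ge1$. If $\pi(P_n^{(k)},D)\le n+2|D|-2-s(D)+1$ and $s(D)<n$, then $P_n^{(k)}$ has a canonical $D$-small configuration; that is, a configuration $C$ that is not $D$-solvable, has $|C|=\pi(P_n^{(k)},D)-1$, has $\mathrm{pot}_D(C)=|D|-1$, and satisfies $C(v)=0$ for every $v$ with $D(v)>0$ and $C(v)$ odd for every $v$ with $D(v)=0$.
   Context: $P_n^{(k)}$ has vertices $v_1,\dots,v_n$ with $v_i\sim v_j$ iff $1\le|i-j|\le k$. A configuration is $C:V\to\mathbb{N}$ with $|C|=\sum_vC(v)$; a target distribution is $D:V\to\mathbb{N}$ with $|D|=\sum_vD(v)$ and $s(D)=|\{v:D(v)>0\}|$. A pebbling step from a vertex with at least two pebbles to a neighbor removes two pebbles there and adds one to the neighbor; $C$ is $D$-solvable if some sequence of pebbling steps results in at least $D(v)$ pebbles on every $v$ simultaneously; $\pi(G,D)$ is the least $m$ such that every configuration of size at least $m$ is $D$-solvable. The potential of $C$ with respect to $D$ is $\mathrm{pot}_D(C)=\sum_v\big(\min\{C(v),D(v)\}+\lfloor \max\{C(v)-D(v),0\}/2\rfloor\big)$ (the maximum number of disjoint "potential moves", each being a pair of pebbles on a common vertex or a single pebble on a target vertex $v$, with at most $D(v)$ singletons used at $v$). -}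

module Defs where

open import Data.Nat using (ℕ; zero; suc; _+_; _∸_; _≤_; _<_; _⊓_; ⌊_/2⌋; ∣_-_∣; _≟_)
open import Data.Nat.DivMod using (_%_)
open import Data.Fin using (Fin; toℕ) renaming (zero to fzero; suc to fsuc)
open import Data.Fin using () renaming (_≟_ to _≟ᶠ_)
open import Data.Product using (Σ; ∃; _×_; _,_)
open import Relation.Nullary using (yes; no)
open import Relation.Binary.PropositionalEquality using (_≡_)

-- Vertices of P_n^(k) are Fin n (v_i ↦ i-1); configurations and target
-- distributions are functions Fin n → ℕ.
Config : ℕ → Set
Config n = Fin n → ℕ

Adj : (n k : ℕ) → Fin n → Fin n → Set
Adj n k i j = 1 ≤ ∣ toℕ i - toℕ j ∣ × ∣ toℕ i - toℕ j ∣ ≤ k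

total : ∀ {n} → (Fin n → ℕ) → ℕ
total {zero} f = 0
total {suc n} f = f fzero + total (λ i → f (fsuc i))

size : ∀ {n} → Config n → ℕ
size = total

pos : ℕ → ℕ
pos zero = 0
pos (suc _) = 1

supp : ∀ {n} → Config n → ℕ
supp D = total (λ v → pos (D v))

pot : ∀ {n} → Config n → Config n → ℕ
pot D C = total (λ v → (C v ⊓ D v) + ⌊ (C v ∸ D v) /2⌋)

-- result of a pebbling step from u to v (u ≠ v since adjacent)
move : ∀ {n} → Config n → Fin n → Fin n → Config n
move C u v w with w ≟ᶠ u
... | yes _ = C u ∸ 2
... | no _ with w ≟ᶠ v
...   | yes _ = suc (C v)
...   | no _ = C w

data Reach (n k : ℕ) (C : Config n) : Config n → Set where
  done : Reach n k C C
  step : ∀ {C'} (u v : Fin n) → Adj n k u v → 2 ≤ C u →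
         Reach n k (move C u v) C' → Reach n k C C'

Solvable : (n k : ℕ) → Config n → Config n → Set
Solvable n k D C = Σ (Config n) λ C' → Reach n k C C' × (∀ v → D v ≤ C' v)

AllSolvableFrom : (n k : ℕ) → Config n → ℕ → Set
AllSolvableFrom n k D m = ∀ (C : Config n) → m ≤ size C → Solvable n k D C

IsPebblingNumber : (n k : ℕ) → Config n → ℕ → Set
IsPebblingNumber n k D p =
  AllSolvableFrom n k D p × (∀ m → AllSolvableFrom n k D m → p ≤ m)

{-# OPTIONS --safe #-}
-- Potential never increases along a pebbling step (a step spends two pebbles,
-- i.e. at least one potential move, to add one pebble, i.e. at most one
-- potential move), and a D-solved configuration has potential at least |D|.
-- So a configuration of potential |D| - 1 is unsolvable. The canonical one puts
-- one pebble on every non-target vertex and 2(|D| - 1) further pebbles on one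
-- non-target vertex w (which exists as s(D) < n). Its size n - s(D) + 2|D| - 2
-- is at least π - 1 by the hypothesis and below π because it is unsolvable.
module Submission where

open import Defs
open import Data.Nat using (ℕ; _+_; _*_; _≤_; _<_)
open import Data.Nat.DivMod using (_%_)
open import Data.Fin using (Fin)
open import Data.Product using (Σ; _×_)
open import Relation.Nullary using (¬_)
open import Relation.Binary.PropositionalEquality using (_≡_)

open import Data.Nat using (zero; suc; _∸_; _⊓_; ⌊_/2⌋; z≤n; s≤s)
open import Data.Nat.Properties
open import Data.Nat.DivMod using ([m+kn]%n≡m%n)
open import Data.Nat.Solver using (module +-*-Solver)
open import Data.Fin using () renaming (zero to fzero; suc to fsuc; _≟_ to _≟ᶠ_)
open import Data.Product using (_,_)
open import Relation.Nullary using (yes; no; contradiction)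
open import Relation.Binary.PropositionalEquality
  using (refl; sym; trans; cong; cong₂; subst; _≢_; module ≡-Reasoning)

total-mono : ∀ {n} (f g : Fin n → ℕ) → (∀ v → f v ≤ g v) → total f ≤ total g
total-mono {zero}  f g f≤g = z≤n
total-mono {suc n} f g f≤g =
  +-mono-≤ (f≤g fzero) (total-mono (λ i → f (fsuc i)) (λ i → g (fsuc i)) (λ i → f≤g (fsuc i)))

total-cong : ∀ {n} {f g : Fin n → ℕ} → (∀ v → f v ≡ g v) → total f ≡ total g
total-cong {zero}  f≡g = refl
total-cong {suc n} f≡g = cong₂ _+_ (f≡g fzero) (total-cong (λ i → f≡g (fsuc i)))

total-+ : ∀ {n} (f g : Fin n → ℕ) → total (λ v → f v + g v) ≡ total f + total g
total-+ {zero}  f g = refl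
total-+ {suc n} f g = begin
  f fzero + g fzero + total (λ i → f (fsuc i) + g (fsuc i))
    ≡⟨ cong (f fzero + g fzero +_) (total-+ (λ i → f (fsuc i)) (λ i → g (fsuc i))) ⟩
  f fzero + g fzero + (F + G)
    ≡⟨ +-*-Solver.solve 4 (λ a b c d → a :+ b :+ (c :+ d) := a :+ c :+ (b :+ d))
         refl (f fzero) (g fzero) F G ⟩
  f fzero + F + (g fzero + G) ∎
  where
  open ≡-Reasoning
  open +-*-Solver using (_:+_; _:=_)
  F = total (λ i → f (fsuc i))
  G = total (λ i → g (fsuc i))

total-*ʳ : ∀ {n} (f : Fin n → ℕ) c → total (λ v → f v * c) ≡ total f * c
total-*ʳ {zero}  f c = refl
total-*ʳ {suc n} f c =
  trans (cong (f fzero * c +_) (total-*ʳ (λ i → f (fsuc i)) c))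
        (sym (*-distribʳ-+ c (f fzero) (total (λ i → f (fsuc i)))))

total-one : ∀ n → total {n} (λ _ → 1) ≡ n
total-one zero    = refl
total-one (suc n) = cong suc (total-one n)

total-zero : ∀ n → total {n} (λ _ → 0) ≡ 0
total-zero zero    = refl
total-zero (suc n) = total-zero n

indicator : ∀ {n} → Fin n → Fin n → ℕ
indicator fzero    fzero    = 1
indicator fzero    (fsuc _) = 0
indicator (fsuc _) fzero    = 0
indicator (fsuc u) (fsuc w) = indicator u w

indicator-self : ∀ {n} (u : Fin n) → indicator u u ≡ 1
indicator-self fzero    = refl
indicator-self (fsuc u) = indicator-self u

indicator-other : ∀ {n} (u w : Fin n) → w ≢ u → indicator u w ≡ 0
indicator-other fzero    fzero    w≢u = contradiction refl w≢u
indicator-other fzero    (fsuc w) w≢u = refl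
indicator-other (fsuc u) fzero    w≢u = refl
indicator-other (fsuc u) (fsuc w) w≢u = indicator-other u w (λ w≡u → w≢u (cong fsuc w≡u))

total-indicator : ∀ {n} (u : Fin n) → total (indicator u) ≡ 1
total-indicator {suc n} fzero    = cong suc (total-zero n)
total-indicator {suc n} (fsuc u) = total-indicator u

total-indicator-* : ∀ {n} (u : Fin n) a → total (λ v → indicator u v * a) ≡ a
total-indicator-* u a =
  trans (total-*ʳ (indicator u) a) (trans (cong (_* a) (total-indicator u)) (+-identityʳ a))

vertexPot : ℕ → ℕ → ℕ
vertexPot c d = c ⊓ d + ⌊ (c ∸ d) /2⌋

⌊suc/2⌋≤suc⌊/2⌋ : ∀ c → ⌊ suc c /2⌋ ≤ suc ⌊ c /2⌋
⌊suc/2⌋≤suc⌊/2⌋ zero          = z≤n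
⌊suc/2⌋≤suc⌊/2⌋ (suc zero)    = s≤s z≤n
⌊suc/2⌋≤suc⌊/2⌋ (suc (suc c)) = s≤s (⌊suc/2⌋≤suc⌊/2⌋ c)

vertexPot-suc : ∀ c d → vertexPot (suc c) d ≤ suc (vertexPot c d)
vertexPot-suc zero    zero          = z≤n
vertexPot-suc (suc c) zero          = ⌊suc/2⌋≤suc⌊/2⌋ (suc c)
vertexPot-suc zero    (suc zero)    = s≤s z≤n
vertexPot-suc zero    (suc (suc d)) = s≤s z≤n
vertexPot-suc (suc c) (suc d)       = s≤s (vertexPot-suc c d)

vertexPot-+2 : ∀ c d → suc (vertexPot c d) ≤ vertexPot (2 + c) d
vertexPot-+2 zero    zero    = ≤-refl
vertexPot-+2 (suc c) zero    = ≤-refl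
vertexPot-+2 zero    (suc d) = s≤s z≤n
vertexPot-+2 (suc c) (suc d) = s≤s (vertexPot-+2 c d)

vertexPot-∸2 : ∀ c d → 2 ≤ c → suc (vertexPot (c ∸ 2) d) ≤ vertexPot c d
vertexPot-∸2 (suc (suc c)) d (s≤s (s≤s _)) = vertexPot-+2 c d

≤vertexPot : ∀ c d → d ≤ c → d ≤ vertexPot c d
≤vertexPot c d d≤c = subst (_≤ vertexPot c d) (m≥n⇒m⊓n≡n d≤c) (m≤m+n (c ⊓ d) _)

vertexPot-zero : ∀ d → vertexPot 0 d ≡ 0
vertexPot-zero zero    = refl
vertexPot-zero (suc d) = refl

vertexPot-odd : ∀ x → vertexPot (1 + x * 2) 0 ≡ x
vertexPot-odd zero    = refl
vertexPot-odd (suc x) = cong suc (vertexPot-odd x)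

-- Summed over w, this gives pot D (move C u v) + 1 ≤ pot D C + 1.
vertexPot-move : ∀ {n} (D C : Config n) (u v w : Fin n) → 2 ≤ C u →
  vertexPot (move C u v w) (D w) + indicator u w ≤ vertexPot (C w) (D w) + indicator v w
vertexPot-move D C u v w 2≤Cu with w ≟ᶠ u
... | yes refl = begin
  vertexPot (C w ∸ 2) (D w) + indicator w w ≡⟨ cong (vertexPot (C w ∸ 2) (D w) +_) (indicator-self w) ⟩
  vertexPot (C w ∸ 2) (D w) + 1             ≡⟨ +-comm _ 1 ⟩
  suc (vertexPot (C w ∸ 2) (D w))           ≤⟨ vertexPot-∸2 (C w) (D w) 2≤Cu ⟩
  vertexPot (C w) (D w)                     ≤⟨ m≤m+n _ _ ⟩
  vertexPot (C w) (D w) + indicator v w     ∎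
  where open ≤-Reasoning
... | no w≢u with w ≟ᶠ v
...   | yes refl = begin
  vertexPot (suc (C w)) (D w) + indicator u w ≡⟨ cong (vertexPot (suc (C w)) (D w) +_) (indicator-other u w w≢u) ⟩
  vertexPot (suc (C w)) (D w) + 0             ≡⟨ +-identityʳ _ ⟩
  vertexPot (suc (C w)) (D w)                 ≤⟨ vertexPot-suc (C w) (D w) ⟩
  suc (vertexPot (C w) (D w))                 ≡⟨ +-comm 1 _ ⟩
  vertexPot (C w) (D w) + 1                   ≡⟨ cong (vertexPot (C w) (D w) +_) (indicator-self w) ⟨
  vertexPot (C w) (D w) + indicator w w       ∎
  where open ≤-Reasoning
...   | no w≢v = ≤-reflexive
  (cong (vertexPot (C w) (D w) +_) (trans (indicator-other u w w≢u) (sym (indicator-other v w w≢v))))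

pot-move : ∀ {n} (D C : Config n) (u v : Fin n) → 2 ≤ C u → pot D (move C u v) ≤ pot D C
pot-move D C u v 2≤Cu = +-cancelʳ-≤ 1 _ _ (begin
  pot D (move C u v) + 1
    ≡⟨ cong (pot D (move C u v) +_) (total-indicator u) ⟨
  pot D (move C u v) + total (indicator u)
    ≡⟨ total-+ (λ w → vertexPot (move C u v w) (D w)) (indicator u) ⟨
  total (λ w → vertexPot (move C u v w) (D w) + indicator u w)
    ≤⟨ total-mono _ _ (λ w → vertexPot-move D C u v w 2≤Cu) ⟩
  total (λ w → vertexPot (C w) (D w) + indicator v w)
    ≡⟨ total-+ (λ w → vertexPot (C w) (D w)) (indicator v) ⟩
  pot D C + total (indicator v)
    ≡⟨ cong (pot D C +_) (total-indicator v) ⟩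
  pot D C + 1 ∎)
  where open ≤-Reasoning

pot-reach : ∀ {n k} (D : Config n) {C C' : Config n} → Reach n k C C' → pot D C' ≤ pot D C
pot-reach D done                   = ≤-refl
pot-reach D (step u v _ 2≤Cu reach) = ≤-trans (pot-reach D reach) (pot-move D _ u v 2≤Cu)

solvable⇒size≤pot : ∀ {n k} (D C : Config n) → Solvable n k D C → size D ≤ pot D C
solvable⇒size≤pot D C (C' , reach , D≤C') =
  ≤-trans (total-mono _ _ (λ v → ≤vertexPot (C' v) (D v) (D≤C' v))) (pot-reach D reach)

pot<size⇒unsolvable : ∀ {n k} (D C : Config n) → pot D C + 1 ≡ size D → ¬ Solvable n k D C
pot<size⇒unsolvable D C pot+1≡ solvable =
  1+n≰n (subst (_≤ pot D C) (trans (sym pot+1≡) (+-comm _ 1)) (solvable⇒size≤pot D C solvable))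

unsolvable-size≡ : ∀ {n k} (D C : Config n) {p} → AllSolvableFrom n k D p →
  ¬ Solvable n k D C → p ≤ size C + 1 → size C + 1 ≡ p
unsolvable-size≡ D C {p} allSolvable unsolvable p≤C+1 =
  ≤-antisym (subst (_≤ p) (+-comm 1 (size C)) C<p) p≤C+1
  where
  C<p : size C < p
  C<p = ≰⇒> (λ p≤C → unsolvable (allSolvable C p≤C))

nonTarget : ∀ {n} (D : Config n) → supp D < n → Σ (Fin n) λ w → D w ≡ 0
nonTarget {suc n} D s<n with D fzero in D0≡
... | zero  = fzero , D0≡
... | suc _ with nonTarget (λ i → D (fsuc i)) (≤-pred s<n)
...   | w , Dw≡0 = fsuc w , Dw≡0

isZero : ℕ → ℕ
isZero zero    = 1
isZero (suc _) = 0

isZero+pos : ∀ d → isZero d + pos d ≡ 1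
isZero+pos zero    = refl
isZero+pos (suc d) = refl

canonical : ∀ {n} → Config n → Fin n → ℕ → Config n
canonical D w a v = isZero (D v) + indicator w v * a * 2

module _ {n} (D : Config n) (w : Fin n) (Dw≡0 : D w ≡ 0) (a : ℕ) where

  indicator-target : ∀ v → 1 ≤ D v → indicator w v ≡ 0
  indicator-target v 1≤Dv = indicator-other w v v≢w
    where
    v≢w : v ≢ w
    v≢w refl = contradiction (subst (1 ≤_) Dw≡0 1≤Dv) λ ()

  canonical-target : ∀ v → 1 ≤ D v → canonical D w a v ≡ 0
  canonical-target v 1≤Dv with D v | 1≤Dv | indicator-target v 1≤Dv
  ... | suc _ | _ | ind≡0 = cong (λ i → i * a * 2) ind≡0

  canonical-nonTarget : ∀ v → D v ≡ 0 → canonical D w a v % 2 ≡ 1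
  canonical-nonTarget v Dv≡0 rewrite Dv≡0 = [m+kn]%n≡m%n 1 (indicator w v * a) 2

  vertexPot-canonical : ∀ v → vertexPot (canonical D w a v) (D v) ≡ indicator w v * a
  vertexPot-canonical v with D v in Dv≡
  ... | zero  = vertexPot-odd (indicator w v * a)
  ... | suc d rewrite indicator-target v (subst (1 ≤_) (sym Dv≡) (s≤s z≤n)) = vertexPot-zero (suc d)

  pot-canonical : pot D (canonical D w a) ≡ a
  pot-canonical = trans (total-cong vertexPot-canonical) (total-indicator-* w a)

  size-canonical : size (canonical D w a) + supp D ≡ n + a * 2
  size-canonical = begin
    size (canonical D w a) + supp D
      ≡⟨ cong (_+ supp D) (total-+ (λ v → isZero (D v)) (λ v → indicator w v * a * 2)) ⟩
    Z + total (λ v → indicator w v * a * 2) + supp D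
      ≡⟨ cong (λ t → Z + t + supp D) (trans (total-*ʳ (λ v → indicator w v * a) 2)
                                            (cong (_* 2) (total-indicator-* w a))) ⟩
    Z + a * 2 + supp D
      ≡⟨ +-*-Solver.solve 3 (λ z b s → z :+ b :+ s := z :+ s :+ b) refl Z (a * 2) (supp D) ⟩
    Z + supp D + a * 2
      ≡⟨ cong (_+ a * 2) (sym (total-+ (λ v → isZero (D v)) (λ v → pos (D v)))) ⟩
    total (λ v → isZero (D v) + pos (D v)) + a * 2
      ≡⟨ cong (_+ a * 2) (trans (total-cong (λ v → isZero+pos (D v))) (total-one n)) ⟩
    n + a * 2 ∎
    where
    open ≡-Reasoning
    open +-*-Solver using (_:+_; _:=_)
    Z = total (λ v → isZero (D v))

  size-canonical-+2 : size (canonical D w a) + 1 + supp D + 1 ≡ n + 2 * (a + 1)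
  size-canonical-+2 = begin
    size C + 1 + supp D + 1
      ≡⟨ solve 2 (λ c s → c :+ con 1 :+ s :+ con 1 := c :+ s :+ con 2) refl (size C) (supp D) ⟩
    size C + supp D + 2  ≡⟨ cong (_+ 2) size-canonical ⟩
    n + a * 2 + 2        ≡⟨ solve 2 (λ m b → m :+ b :* con 2 :+ con 2 := m :+ con 2 :* (b :+ con 1)) refl n a ⟩
    n + 2 * (a + 1)      ∎
    where
    open ≡-Reasoning
    open +-*-Solver using (solve; _:+_; _:*_; _:=_; con)
    C = canonical D w a

lemma28 : (n k : ℕ) → 1 ≤ n → 1 ≤ k → (D : Config n) → 1 ≤ size D →
    (p : ℕ) → IsPebblingNumber n k D p →
    p + supp D + 1 ≤ n + 2 * size D →
    supp D < n →
    Σ (Config n) λ C →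
      ¬ Solvable n k D C
      × size C + 1 ≡ p
      × pot D C + 1 ≡ size D
      × (∀ v → 1 ≤ D v → C v ≡ 0)
      × (∀ v → D v ≡ 0 → C v % 2 ≡ 1)
lemma28 n k _ _ D 1≤|D| p (allSolvable , _) p-bound s<n with nonTarget D s<n
... | w , Dw≡0 =
  C , unsolvable , unsolvable-size≡ D C allSolvable unsolvable p≤C+1
    , potC+1 , canonical-target D w Dw≡0 a , canonical-nonTarget D w Dw≡0 a
  where
  a = size D ∸ 1
  C = canonical D w a

  a+1≡|D| : a + 1 ≡ size D
  a+1≡|D| = trans (+-comm a 1) (m+[n∸m]≡n 1≤|D|)

  potC+1 : pot D C + 1 ≡ size D
  potC+1 = trans (cong (_+ 1) (pot-canonical D w Dw≡0 a)) a+1≡|D|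

  unsolvable : ¬ Solvable n k D C
  unsolvable = pot<size⇒unsolvable D C potC+1

  p≤C+1 : p ≤ size C + 1
  p≤C+1 = +-cancelʳ-≤ (supp D) _ _ (+-cancelʳ-≤ 1 _ _ (subst (p + supp D + 1 ≤_)
    (sym (trans (size-canonical-+2 D w Dw≡0 a) (cong (λ d → n + 2 * d) a+1≡|D|))) p-bound))
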